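{- The sloping binary numbers $s(n)$ have average order $n+O(\log n)$; that is, as $N\to\infty$, $\sum_{n=1}^{N}s(n)=\sum_{n=1}^{N}n+O(N\log N)$.
   Context: For integers $m\ge 0$, $k\ge0$ let $\operatorname{bit}_k(m)=\lfloor m/2^k\rfloor\bmod 2$. For $n\ge 0$ the sloping binary number is $s(n)=\sum_{k\ge 0}\operatorname{bit}_k(n+k)2^k$ (the $2^k$ digit of $s(n)$ is the $2^k$ digit of $n+k$). "Average order" is in the sense of Hardy and Wright: a function $g$ is an average order of $s$ if $\sum_{n\le N}s(n)\sim\sum_{n\le N}g(n)$; here the claim is the quantitative statement given. -}

module Defs where

open import Data.Nat using (ℕ; zero; suc; _+_; _*_; _^_)
open import Data.Nat.DivMod using (_/_; _%_)
open import Data.Nat.Properties using (m^n≢0)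

bit : ℕ → ℕ → ℕ
bit k m = (_/_ m (2 ^ k) {{m^n≢0 2 k}}) % 2

sumBelow : ℕ → (ℕ → ℕ) → ℕ
sumBelow zero    f = 0
sumBelow (suc K) f = sumBelow K f + f K

-- sloping binary number s(n) = Σ_{k ≥ 0} bit_k(n+k) 2^k.
-- For k ≥ n+1 we have n+k ≤ 2k-1 < 2^k, so bit_k(n+k) = 0; hence the
-- infinite sum equals the finite sum over k < n+1 (exact, not an approximation).
s : ℕ → ℕ
s n = sumBelow (suc n) (λ k → bit k (n + k) * 2 ^ k)

sum1to : ℕ → (ℕ → ℕ) → ℕ
sum1to zero    f = 0
sum1to (suc N) f = sum1to N f + f (suc N)

{-# OPTIONS --safe #-}
module Submission where

-- Writing n = Σ_k bit_k(n) 2^k and s(n) = Σ_k bit_k(n+k) 2^k, with k ≤ M as soon as n < 2^M, and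
-- exchanging the order of summation, the coefficient of 2^k in Σ_{n≤N} (s(n) - n) is
-- Σ_{n≤N} bit_k(n+k) - Σ_{n≤N} bit_k(n): a sum of 0/1 values shifted by k, hence at most k in
-- absolute value. So the error is at most Σ_{k≤M} k 2^k ≤ (M+1) 2^(M+1), which is O(N log N)
-- for M = ⌊log₂ N⌋ + 1.

open import Defs
open import Data.Nat using (ℕ; _*_; _≥_)
open import Data.Nat.Logarithm using (⌊log₂_⌋)
open import Data.Integer using (ℤ; +_; _-_; ∣_∣)
open import Data.Product using (∃₂)
open import Data.Nat using (_≤_)

open import Data.Integer.Properties using ([+m]-[+n]≡m⊖n; ∣⊖∣-≤; ∣m⊖n∣≡∣n⊖m∣)
-- Renamed because the integer ∣_∣ and _-_ in scope would make ∣ m - n ∣ ambiguous.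
open import Data.Nat using (zero; suc; _+_; _∸_; _^_; _<_; _⊔_; NonZero; >-nonZero; z≤n; s≤s; s≤s⁻¹; ⌊_/2⌋; ⌈_/2⌉)
  renaming (∣_-_∣ to ∣_-_∣ℕ)
open import Data.Nat.DivMod using (_/_; _%_; m%n<n; n%1≡0; m≡m%n+[m/n]*n; m∣n⇒o%n%m≡o%m; m%[n*o]/o≡m/o%n; m<n⇒m/n≡0; m<n⇒m%n≡m)
open import Data.Nat.Divisibility using (n∣m*n)
open import Data.Nat.Logarithm using (⌊log₂⌋-mono-≤; ⌊log₂[2^n]⌋≡n; ⌊log₂⌊n/2⌋⌋≡⌊log₂n⌋∸1)
open import Data.Nat.Properties
open import Algebra.Properties.CommutativeSemigroup +-commutativeSemigroup using (interchange; xy∙z≈xz∙y)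
open import Data.Nat.Tactic.RingSolver using (solve-∀)
open import Data.Product using (_,_)
open import Data.Sum using (inj₁; inj₂)
open import Relation.Binary.PropositionalEquality
open import Relation.Nullary using (contradiction)

sumBelow-cong : ∀ K {f g : ℕ → ℕ} → (∀ k → f k ≡ g k) → sumBelow K f ≡ sumBelow K g
sumBelow-cong zero    f≗g = refl
sumBelow-cong (suc K) f≗g = cong₂ _+_ (sumBelow-cong K f≗g) (f≗g K)

sumBelow-mono-≤ : ∀ K {f g : ℕ → ℕ} → (∀ k → f k ≤ g k) → sumBelow K f ≤ sumBelow K g
sumBelow-mono-≤ zero    f≤g = z≤n
sumBelow-mono-≤ (suc K) f≤g = +-mono-≤ (sumBelow-mono-≤ K f≤g) (f≤g K)

sumBelow-zero : ∀ K → sumBelow K (λ _ → 0) ≡ 0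
sumBelow-zero zero    = refl
sumBelow-zero (suc K) = trans (+-identityʳ _) (sumBelow-zero K)

sumBelow-distrib-+ : ∀ K (f g : ℕ → ℕ) →
  sumBelow K (λ k → f k + g k) ≡ sumBelow K f + sumBelow K g
sumBelow-distrib-+ zero    f g = refl
sumBelow-distrib-+ (suc K) f g = trans
  (cong (_+ (f K + g K)) (sumBelow-distrib-+ K f g))
  (interchange (sumBelow K f) (sumBelow K g) (f K) (g K))

sumBelow-vanishing : ∀ a d (f : ℕ → ℕ) → (∀ k → a ≤ k → f k ≡ 0) →
  sumBelow (a + d) f ≡ sumBelow a f
sumBelow-vanishing a zero    f f≡0 = cong (λ b → sumBelow b f) (+-identityʳ a)
sumBelow-vanishing a (suc d) f f≡0 = begin
  sumBelow (a + suc d) f          ≡⟨ cong (λ b → sumBelow b f) (+-suc a d) ⟩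
  sumBelow (a + d) f + f (a + d)  ≡⟨ cong₂ _+_ (sumBelow-vanishing a d f f≡0) (f≡0 (a + d) (m≤m+n a d)) ⟩
  sumBelow a f + 0                ≡⟨ +-identityʳ _ ⟩
  sumBelow a f                    ∎
  where open ≡-Reasoning

∣m+n-o+p∣≤∣m-o∣+∣n-p∣ : ∀ m n o p → ∣ m + n - o + p ∣ℕ ≤ ∣ m - o ∣ℕ + ∣ n - p ∣ℕ
∣m+n-o+p∣≤∣m-o∣+∣n-p∣ m n o p = begin
  ∣ m + n - o + p ∣ℕ                       ≤⟨ ∣-∣-triangle (m + n) (o + n) (o + p) ⟩
  ∣ m + n - o + n ∣ℕ + ∣ o + n - o + p ∣ℕ  ≡⟨ cong₂ _+_ ∣m+n-o+n∣≡∣m-o∣ (∣m+n-m+o∣≡∣n-o∣ o n p) ⟩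
  ∣ m - o ∣ℕ + ∣ n - p ∣ℕ                  ∎
  where
  open ≤-Reasoning
  ∣m+n-o+n∣≡∣m-o∣ : ∣ m + n - o + n ∣ℕ ≡ ∣ m - o ∣ℕ
  ∣m+n-o+n∣≡∣m-o∣ = trans (cong₂ ∣_-_∣ℕ (+-comm m n) (+-comm o n)) (∣m+n-m+o∣≡∣n-o∣ n m o)

m+n≡o+p⇒∣m-o∣≡∣p-n∣ : ∀ m n o p → m + n ≡ o + p → ∣ m - o ∣ℕ ≡ ∣ p - n ∣ℕ
m+n≡o+p⇒∣m-o∣≡∣p-n∣ m n o p m+n≡o+p = begin
  ∣ m - o ∣ℕ          ≡⟨ ∣m+n-m+o∣≡∣n-o∣ n m o ⟨
  ∣ n + m - n + o ∣ℕ  ≡⟨ cong₂ ∣_-_∣ℕ (trans (+-comm n m) m+n≡o+p) (+-comm n o) ⟩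
  ∣ o + p - o + n ∣ℕ  ≡⟨ ∣m+n-m+o∣≡∣n-o∣ o p n ⟩
  ∣ p - n ∣ℕ          ∎
  where open ≡-Reasoning

∣sumBelow-sumBelow∣≤sumBelow∣-∣ : ∀ K (f g : ℕ → ℕ) →
  ∣ sumBelow K f - sumBelow K g ∣ℕ ≤ sumBelow K (λ k → ∣ f k - g k ∣ℕ)
∣sumBelow-sumBelow∣≤sumBelow∣-∣ zero    f g = z≤n
∣sumBelow-sumBelow∣≤sumBelow∣-∣ (suc K) f g = ≤-trans
  (∣m+n-o+p∣≤∣m-o∣+∣n-p∣ (sumBelow K f) (f K) (sumBelow K g) (g K))
  (+-monoˡ-≤ ∣ f K - g K ∣ℕ (∣sumBelow-sumBelow∣≤sumBelow∣-∣ K f g))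

sumBelow[k*2^k]≤K*2^K : ∀ K → sumBelow K (λ k → k * 2 ^ k) ≤ K * 2 ^ K
sumBelow[k*2^k]≤K*2^K zero    = z≤n
sumBelow[k*2^k]≤K*2^K (suc K) = begin
  sumBelow K (λ k → k * 2 ^ k) + K * 2 ^ K  ≤⟨ +-monoˡ-≤ (K * 2 ^ K) (sumBelow[k*2^k]≤K*2^K K) ⟩
  K * 2 ^ K + K * 2 ^ K                     ≡⟨ double K (2 ^ K) ⟩
  K * 2 ^ suc K                             ≤⟨ *-monoˡ-≤ (2 ^ suc K) (n≤1+n K) ⟩
  suc K * 2 ^ suc K                         ∎
  where
  open ≤-Reasoning
  double : ∀ K a → K * a + K * a ≡ K * (2 * a)
  double = solve-∀

sum1to-cong : ∀ N {f g : ℕ → ℕ} → (∀ n → n ≤ N → f n ≡ g n) → sum1to N f ≡ sum1to N g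
sum1to-cong zero    f≗g = refl
sum1to-cong (suc N) f≗g =
  cong₂ _+_ (sum1to-cong N (λ n n≤N → f≗g n (m≤n⇒m≤1+n n≤N))) (f≗g (suc N) ≤-refl)

sum1to-*ʳ : ∀ N (f : ℕ → ℕ) c → sum1to N (λ n → f n * c) ≡ sum1to N f * c
sum1to-*ʳ zero    f c = refl
sum1to-*ʳ (suc N) f c = trans
  (cong (_+ f (suc N) * c) (sum1to-*ʳ N f c))
  (sym (*-distribʳ-+ c (sum1to N f) (f (suc N))))

sum1to-sumBelow-comm : ∀ N K (F : ℕ → ℕ → ℕ) →
  sum1to N (λ n → sumBelow K (F n)) ≡ sumBelow K (λ k → sum1to N (λ n → F n k))
sum1to-sumBelow-comm zero    K F = sym (sumBelow-zero K)
sum1to-sumBelow-comm (suc N) K F = trans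
  (cong (_+ sumBelow K (F (suc N))) (sum1to-sumBelow-comm N K F))
  (sym (sumBelow-distrib-+ K (λ k → sum1to N (λ n → F n k)) (F (suc N))))

sum1to-expansion : ∀ N K {f : ℕ → ℕ} (d : ℕ → ℕ → ℕ) (w : ℕ → ℕ) →
  (∀ n → n ≤ N → f n ≡ sumBelow K (λ k → d n k * w k)) →
  sum1to N f ≡ sumBelow K (λ k → sum1to N (λ n → d n k) * w k)
sum1to-expansion N K {f} d w f≡ = begin
  sum1to N f                                        ≡⟨ sum1to-cong N f≡ ⟩
  sum1to N (λ n → sumBelow K (λ k → d n k * w k))   ≡⟨ sum1to-sumBelow-comm N K (λ n k → d n k * w k) ⟩
  sumBelow K (λ k → sum1to N (λ n → d n k * w k))   ≡⟨ sumBelow-cong K (λ k → sum1to-*ʳ N (λ n → d n k) (w k)) ⟩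
  sumBelow K (λ k → sum1to N (λ n → d n k) * w k)   ∎
  where open ≡-Reasoning

sum1to-suc : ∀ N (f : ℕ → ℕ) → sum1to N (λ n → f (suc n)) + f 1 ≡ sum1to N f + f (suc N)
sum1to-suc zero    f = refl
sum1to-suc (suc N) f = trans
  (xy∙z≈xz∙y (sum1to N (λ n → f (suc n))) (f (suc (suc N))) (f 1))
  (cong (_+ f (suc (suc N))) (sum1to-suc N f))

∣sum1to-shift∣≤ : ∀ N k B (h : ℕ → ℕ) → (∀ m → h m ≤ B) →
  ∣ sum1to N (λ n → h (n + k)) - sum1to N h ∣ℕ ≤ k * B
∣sum1to-shift∣≤ N zero B h h≤B = ≤-reflexive (trans
  (cong (λ x → ∣ x - sum1to N h ∣ℕ) (sum1to-cong N (λ n _ → cong h (+-identityʳ n))))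
  (∣n-n∣≡0 (sum1to N h)))
∣sum1to-shift∣≤ N (suc k) B h h≤B = begin
  ∣ S (suc k) - sum1to N h ∣ℕ                   ≤⟨ ∣-∣-triangle (S (suc k)) (S k) (sum1to N h) ⟩
  ∣ S (suc k) - S k ∣ℕ + ∣ S k - sum1to N h ∣ℕ  ≤⟨ +-mono-≤ one-step (∣sum1to-shift∣≤ N k B h h≤B) ⟩
  B + k * B                                      ∎
  where
  open ≤-Reasoning
  S : ℕ → ℕ
  S j = sum1to N (λ n → h (n + j))
  hₖ : ℕ → ℕ
  hₖ m = h (m + k)
  one-step : ∣ S (suc k) - S k ∣ℕ ≤ B
  one-step = begin
    ∣ S (suc k) - S k ∣ℕ                    ≡⟨ cong (λ x → ∣ x - S k ∣ℕ) (sum1to-cong N (λ n _ → cong h (+-suc n k))) ⟩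
    ∣ sum1to N (λ n → hₖ (suc n)) - S k ∣ℕ  ≡⟨ m+n≡o+p⇒∣m-o∣≡∣p-n∣ _ (hₖ 1) (S k) _ (sum1to-suc N hₖ) ⟩
    ∣ hₖ (suc N) - hₖ 1 ∣ℕ                  ≤⟨ ∣m-n∣≤m⊔n (hₖ (suc N)) (hₖ 1) ⟩
    hₖ (suc N) ⊔ hₖ 1                       ≤⟨ ⊔-lub (h≤B _) (h≤B _) ⟩
    B                                       ∎

bit≤1 : ∀ k m → bit k m ≤ 1
bit≤1 k m = s≤s⁻¹ (m%n<n (_/_ m (2 ^ k) ⦃ m^n≢0 2 k ⦄) 2)

bit-vanishes : ∀ k {m} → m < 2 ^ k → bit k m ≡ 0
bit-vanishes k m<2^k = cong (_% 2) (m<n⇒m/n≡0 ⦃ m^n≢0 2 k ⦄ m<2^k)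

%2^K-expansion : ∀ K n → _%_ n (2 ^ K) ⦃ m^n≢0 2 K ⦄ ≡ sumBelow K (λ k → bit k n * 2 ^ k)
%2^K-expansion zero    n = n%1≡0 n
%2^K-expansion (suc K) n = begin
  n % 2 ^ suc K                                          ≡⟨ m≡m%n+[m/n]*n (n % 2 ^ suc K) (2 ^ K) ⟩
  n % 2 ^ suc K % 2 ^ K + n % 2 ^ suc K / 2 ^ K * 2 ^ K  ≡⟨ cong₂ (λ r q → r + q * 2 ^ K) low-digits top-digit ⟩
  n % 2 ^ K + bit K n * 2 ^ K                            ≡⟨ cong (_+ bit K n * 2 ^ K) (%2^K-expansion K n) ⟩
  sumBelow K (λ k → bit k n * 2 ^ k) + bit K n * 2 ^ K   ∎
  where
  open ≡-Reasoning
  instance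
    2^K≢0 : NonZero (2 ^ K)
    2^K≢0 = m^n≢0 2 K
    2^[1+K]≢0 : NonZero (2 ^ suc K)
    2^[1+K]≢0 = m^n≢0 2 (suc K)
  low-digits : n % 2 ^ suc K % 2 ^ K ≡ n % 2 ^ K
  low-digits = m∣n⇒o%n%m≡o%m (2 ^ K) (2 ^ suc K) n (n∣m*n 2)
  top-digit : n % 2 ^ suc K / 2 ^ K ≡ bit K n
  top-digit = m%[n*o]/o≡m/o%n n 2 (2 ^ K)

binary-expansion : ∀ K {n} → n < 2 ^ K → n ≡ sumBelow K (λ k → bit k n * 2 ^ k)
binary-expansion K {n} n<2^K = trans (sym (m<n⇒m%n≡m ⦃ m^n≢0 2 K ⦄ n<2^K)) (%2^K-expansion K n)

2^n+2^n≡2^[1+n] : ∀ n → 2 ^ n + 2 ^ n ≡ 2 ^ suc n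
2^n+2^n≡2^[1+n] n = cong (_+_ (2 ^ n)) (sym (+-identityʳ (2 ^ n)))

n<2^n : ∀ n → n < 2 ^ n
n<2^n zero    = s≤s z≤n
n<2^n (suc n) = ≤-trans (+-mono-≤ (m^n>0 2 n) (n<2^n n)) (≤-reflexive (2^n+2^n≡2^[1+n] n))

sloping-digit-vanishes : ∀ j {n} → n < 2 ^ j → bit (suc j) (n + suc j) ≡ 0
sloping-digit-vanishes j n<2^j = bit-vanishes (suc j)
  (≤-trans (+-mono-<-≤ n<2^j (n<2^n j)) (≤-reflexive (2^n+2^n≡2^[1+n] j)))

s-expansion : ∀ M {n} → n < 2 ^ M → s n ≡ sumBelow (suc M) (λ k → bit k (n + k) * 2 ^ k)
s-expansion M {n} n<2^M = begin
  sumBelow (suc n) t          ≡⟨ sumBelow-vanishing (suc n) (suc M) t beyond-n ⟨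
  sumBelow (suc n + suc M) t  ≡⟨ cong (λ a → sumBelow a t) (+-comm (suc n) (suc M)) ⟩
  sumBelow (suc M + suc n) t  ≡⟨ sumBelow-vanishing (suc M) (suc n) t beyond-M ⟩
  sumBelow (suc M) t          ∎
  where
  open ≡-Reasoning
  t : ℕ → ℕ
  t k = bit k (n + k) * 2 ^ k
  t-vanishes : ∀ j → n < 2 ^ j → t (suc j) ≡ 0
  t-vanishes j n<2^j = cong (_* 2 ^ suc j) (sloping-digit-vanishes j n<2^j)
  beyond-n : ∀ k → suc n ≤ k → t k ≡ 0
  beyond-n (suc j) (s≤s n≤j) = t-vanishes j (≤-<-trans n≤j (n<2^n j))
  beyond-M : ∀ k → suc M ≤ k → t k ≡ 0
  beyond-M (suc j) (s≤s M≤j) = t-vanishes j (<-≤-trans n<2^M (^-monoʳ-≤ 2 M≤j))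

∣sum1to-s-sum1to-id∣≤ : ∀ N M → N < 2 ^ M →
  ∣ sum1to N s - sum1to N (λ n → n) ∣ℕ ≤ sumBelow (suc M) (λ k → k * 2 ^ k)
∣sum1to-s-sum1to-id∣≤ N M N<2^M = begin
  ∣ sum1to N s - sum1to N (λ n → n) ∣ℕ
    ≡⟨ cong₂ ∣_-_∣ℕ sum-s sum-id ⟩
  ∣ sumBelow K (λ k → A k * 2 ^ k) - sumBelow K (λ k → B k * 2 ^ k) ∣ℕ
    ≤⟨ ∣sumBelow-sumBelow∣≤sumBelow∣-∣ K (λ k → A k * 2 ^ k) (λ k → B k * 2 ^ k) ⟩
  sumBelow K (λ k → ∣ A k * 2 ^ k - B k * 2 ^ k ∣ℕ)
    ≡⟨ sumBelow-cong K (λ k → *-distribʳ-∣-∣ (2 ^ k) (A k) (B k)) ⟨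
  sumBelow K (λ k → ∣ A k - B k ∣ℕ * 2 ^ k)
    ≤⟨ sumBelow-mono-≤ K (λ k → *-monoˡ-≤ (2 ^ k) (∣A-B∣≤ k)) ⟩
  sumBelow K (λ k → k * 2 ^ k) ∎
  where
  open ≤-Reasoning
  K = suc M
  A B : ℕ → ℕ
  A k = sum1to N (λ n → bit k (n + k))
  B k = sum1to N (bit k)
  n≤N⇒n<2^M : ∀ n → n ≤ N → n < 2 ^ M
  n≤N⇒n<2^M n n≤N = ≤-<-trans n≤N N<2^M
  sum-s : sum1to N s ≡ sumBelow K (λ k → A k * 2 ^ k)
  sum-s = sum1to-expansion N K (λ n k → bit k (n + k)) (2 ^_) (λ n n≤N → s-expansion M (n≤N⇒n<2^M n n≤N))
  sum-id : sum1to N (λ n → n) ≡ sumBelow K (λ k → B k * 2 ^ k)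
  sum-id = sum1to-expansion N K (λ n k → bit k n) (2 ^_)
    (λ n n≤N → binary-expansion K (<-≤-trans (n≤N⇒n<2^M n n≤N) (^-monoʳ-≤ 2 (n≤1+n M))))
  ∣A-B∣≤ : ∀ k → ∣ A k - B k ∣ℕ ≤ k
  ∣A-B∣≤ k = ≤-trans (∣sum1to-shift∣≤ N k 1 (bit k) (bit≤1 k)) (≤-reflexive (*-identityʳ k))

n<2^[1+⌊log₂n⌋] : ∀ n → n < 2 ^ suc ⌊log₂ n ⌋
n<2^[1+⌊log₂n⌋] n = ≰⇒> λ 2^[1+L]≤n →
  1+n≰n (subst (_≤ ⌊log₂ n ⌋) (⌊log₂[2^n]⌋≡n (suc ⌊log₂ n ⌋)) (⌊log₂⌋-mono-≤ 2^[1+L]≤n))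

2*⌊n/2⌋≤n : ∀ n → 2 * ⌊ n /2⌋ ≤ n
2*⌊n/2⌋≤n n = begin
  2 * ⌊ n /2⌋          ≡⟨ cong (_+_ ⌊ n /2⌋) (+-identityʳ ⌊ n /2⌋) ⟩
  ⌊ n /2⌋ + ⌊ n /2⌋    ≤⟨ +-monoʳ-≤ ⌊ n /2⌋ (⌊n/2⌋≤⌈n/2⌉ n) ⟩
  ⌊ n /2⌋ + ⌈ n /2⌉    ≡⟨ ⌊n/2⌋+⌈n/2⌉≡n n ⟩
  n                    ∎
  where open ≤-Reasoning

2^⌊log₂n⌋≤n : ∀ n .{{_ : NonZero n}} → 2 ^ ⌊log₂ n ⌋ ≤ n
2^⌊log₂n⌋≤n n = go ⌊log₂ n ⌋ n refl
  where
  go : ∀ L n .{{_ : NonZero n}} → ⌊log₂ n ⌋ ≡ L → 2 ^ L ≤ n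
  go zero    (suc n)          _    = s≤s z≤n
  go (suc L) 1                log≡ = contradiction (trans (sym (⌊log₂[2^n]⌋≡n 0)) log≡) λ ()
  go (suc L) n@(suc (suc _)) log≡ =
    ≤-trans (*-monoʳ-≤ 2 (go L ⌊ n /2⌋ (trans (⌊log₂⌊n/2⌋⌋≡⌊log₂n⌋∸1 n) (cong (_∸ 1) log≡)))) (2*⌊n/2⌋≤n n)

[2+L]*2^[2+L]≤12*[N*L] : ∀ {N L} → 1 ≤ L → 2 ^ L ≤ N → (2 + L) * 2 ^ (2 + L) ≤ 12 * (N * L)
[2+L]*2^[2+L]≤12*[N*L] {N} {L} 1≤L 2^L≤N = begin
  (2 + L) * (2 * (2 * 2 ^ L))  ≤⟨ *-mono-≤ 2+L≤3*L (*-monoʳ-≤ 2 (*-monoʳ-≤ 2 2^L≤N)) ⟩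
  (3 * L) * (2 * (2 * N))      ≡⟨ regroup L N ⟩
  12 * (N * L)                 ∎
  where
  open ≤-Reasoning
  2+L≤3*L : 2 + L ≤ 3 * L
  2+L≤3*L = ≤-trans (+-monoˡ-≤ L (*-monoʳ-≤ 2 1≤L)) (≤-reflexive (+-comm (2 * L) L))
  regroup : ∀ L N → (3 * L) * (2 * (2 * N)) ≡ 12 * (N * L)
  regroup = solve-∀

∣[+m]-[+n]∣≡∣m-n∣ : ∀ m n → ∣ + m - + n ∣ ≡ ∣ m - n ∣ℕ
∣[+m]-[+n]∣≡∣m-n∣ m n with ≤-total m n
... | inj₁ m≤n = trans (cong ∣_∣ ([+m]-[+n]≡m⊖n m n))
  (trans (∣⊖∣-≤ m≤n) (sym (m≤n⇒∣m-n∣≡n∸m m≤n)))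
... | inj₂ n≤m = trans (cong ∣_∣ ([+m]-[+n]≡m⊖n m n))
  (trans (∣m⊖n∣≡∣n⊖m∣ m n) (trans (∣⊖∣-≤ n≤m) (sym (m≤n⇒∣n-m∣≡n∸m n≤m))))

theorem8 : ∃₂ λ (C N₀ : ℕ) → ∀ (N : ℕ) → N ≥ N₀ →
    ∣ + sum1to N s - + sum1to N (λ n → n) ∣ ≤ C * (N * ⌊log₂ N ⌋)
theorem8 = 12 , 2 , bound
  where
  bound : ∀ N → N ≥ 2 → ∣ + sum1to N s - + sum1to N (λ n → n) ∣ ≤ 12 * (N * ⌊log₂ N ⌋)
  bound N N≥2 = begin
    ∣ + sum1to N s - + sum1to N (λ n → n) ∣  ≡⟨ ∣[+m]-[+n]∣≡∣m-n∣ (sum1to N s) (sum1to N (λ n → n)) ⟩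
    ∣ sum1to N s - sum1to N (λ n → n) ∣ℕ     ≤⟨ ∣sum1to-s-sum1to-id∣≤ N (suc L) (n<2^[1+⌊log₂n⌋] N) ⟩
    sumBelow (2 + L) (λ k → k * 2 ^ k)       ≤⟨ sumBelow[k*2^k]≤K*2^K (2 + L) ⟩
    (2 + L) * 2 ^ (2 + L)                    ≤⟨ [2+L]*2^[2+L]≤12*[N*L] 1≤L (2^⌊log₂n⌋≤n N) ⟩
    12 * (N * L)                             ∎
    where
    open ≤-Reasoning
    L = ⌊log₂ N ⌋
    1≤L : 1 ≤ L
    1≤L = subst (_≤ L) (⌊log₂[2^n]⌋≡n 1) (⌊log₂⌋-mono-≤ N≥2)
    instance
      N≢0 : NonZero N
      N≢0 = >-nonZero (≤-trans (s≤s z≤n) N≥2)
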